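{- For all sufficiently large $k$ and all sufficiently large $\Delta$ (depending on $k$), a random $k$-AND formula with $m=\Delta n$ clauses on $n$ variables has, with high probability (as $n\to\infty$), the following property: for every truth assignment to the variables, at most a $2^{ -k^{3/4}/100}$ fraction of the clauses have more than $k/2+k^{7/8}$ of their literals satisfied.
   Context: A random $k$-AND formula with $m$ clauses on variables $x_1,\dots,x_n$ consists of $m$ independent clauses, each a conjunction of $k$ literals on a uniformly random set of $k$ distinct variables, with each variable independently negated or not with probability $1/2$. A literal is satisfied by a truth assignment if it evaluates to true (i.e., the variable takes the value dictated by the clause).
   Formalization: The clause density Δ takes only positive rational values, the number of clauses being the integer part of Δn. -}

module Defs where

open import Data.Nat using (ℕ; zero; suc; _+_; _*_; _∸_; _^_; _≤_; _<_; _/_)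
open import Data.Nat.Base using (_<ᵇ_)
open import Data.Bool using (Bool; true; false; _∧_; if_then_else_; not)
open import Data.Fin using (Fin) renaming (_≟_ to _≟ᶠ_)
open import Data.List using (List; []; _∷_; [_]; map; concatMap; filter; length; allFin)
open import Data.List.Relation.Unary.All using (All)
open import Data.List.Relation.Binary.Sublist.Propositional using (_⊆_)
open import Data.Vec using (Vec; []; _∷_; toList)
open import Data.Product using (_×_; _,_; proj₁; proj₂; ∃; Σ)
open import Relation.Nullary.Decidable using (⌊_⌋; does)

allVecs : {A : Set} → List A → (k : ℕ) → List (Vec A k)
allVecs xs zero    = [ [] ]
allVecs xs (suc k) = concatMap (λ x → map (x ∷_) (allVecs xs k)) xs

-- A literal on variables x_0..x_{n-1}: (variable, sign).  Sign true = the clause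
-- demands the variable be true (unnegated); false = negated literal.
Lit : ℕ → Set
Lit n = Fin n × Bool

allLits : (n : ℕ) → List (Lit n)
allLits n = concatMap (λ i → (i , true) ∷ (i , false) ∷ []) (allFin n)

_∈ᵇ_ : {n : ℕ} → Fin n → List (Fin n) → Bool
i ∈ᵇ []       = false
i ∈ᵇ (j ∷ js) = if does (i ≟ᶠ j) then true else (i ∈ᵇ js)

distinctᵇ : {n : ℕ} → List (Fin n) → Bool
distinctᵇ []       = true
distinctᵇ (i ∷ is) = not (i ∈ᵇ is) ∧ distinctᵇ is

-- A k-AND clause: k literals on k distinct variables.  The list of all such
-- (ordered) clauses; choosing uniformly from it gives a uniformly random k-set of
-- variables with independent uniform signs.
Clause : ℕ → ℕ → Set
Clause n k = Vec (Lit n) k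

allClauses : (n k : ℕ) → List (Clause n k)
allClauses n k = filter (λ c → Data.Bool._≟_ (distinctᵇ (toList (Data.Vec.map proj₁ c))) true)
                        (allVecs (allLits n) k)
  where import Data.Bool
        import Data.Vec

-- A k-AND formula with m clauses; the sample space of the random formula is the
-- list of all of them (uniform distribution = counting).
Formula : ℕ → ℕ → ℕ → Set
Formula n k m = Vec (Clause n k) m

allFormulas : (n k m : ℕ) → List (Formula n k m)
allFormulas n k m = allVecs (allClauses n k) m

Assignment : ℕ → Set
Assignment n = Fin n → Bool

litSat : {n : ℕ} → Assignment n → Lit n → Bool
litSat σ (i , s) = does (Data.Bool._≟_ (σ i) s)
  where import Data.Bool

numSat : {n k : ℕ} → Assignment n → Clause n k → ℕ
numSat σ []       = 0
numSat σ (l ∷ ls) = (if litSat σ l then 1 else 0) + numSat σ ls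

-- heavy k c  ⇔  c > k/2 + k^(7/8)
--   ⇔ 2c - k > 2 k^(7/8)  ⇔  (2c > k and (2c - k)^8 > 2^8 * k^7)
heavy : ℕ → ℕ → Bool
heavy k c = (k <ᵇ 2 * c) ∧ ((2 ^ 8) * (k ^ 7) <ᵇ (2 * c ∸ k) ^ 8)

numHeavy : {n k m : ℕ} → Assignment n → Formula n k m → ℕ
numHeavy {k = k} σ []       = 0
numHeavy {k = k} σ (C ∷ Cs) = (if heavy k (numSat σ C) then 1 else 0) + numHeavy σ Cs

-- FracAtMost k b m  ⇔  b / m ≤ 2^(-k^(3/4)/100), i.e. b * 2^t ≤ m with t = k^(3/4)/100.
-- Since 2^t is the supremum of 2^(a/c) over rationals a/c ≤ t, this holds iff
-- for all a, c with c > 0 and a/c ≤ t (⇔ (100a)^4 ≤ k^3 c^4): b^c * 2^a ≤ m^c.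
FracAtMost : ℕ → ℕ → ℕ → Set
FracAtMost k b m = (a c : ℕ) → 0 < c → (100 * a) ^ 4 ≤ (k ^ 3) * (c ^ 4) → (b ^ c) * (2 ^ a) ≤ m ^ c

Good : {n k m : ℕ} → Formula n k m → Set
Good {n} {k} {m} F = (σ : Assignment n) → FracAtMost k (numHeavy σ F) m

-- "With high probability as n → ∞" for a family of properties P n of formulas in
-- allFormulas n k (m n): for every j, for all large n, at least a (1 - 1/(j+1))
-- fraction of the (distinct) formulas satisfy P n; witnessed by a sublist.
WHP : (k : ℕ) (m : ℕ → ℕ) → ((n : ℕ) → Formula n k (m n) → Set) → Set
WHP k m P = (j : ℕ) → ∃ λ N → (n : ℕ) → N ≤ n →
  Σ (List (Formula n k (m n))) λ good →
    (good ⊆ allFormulas n k (m n)) × All (P n) good ×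
    (j * length (allFormulas n k (m n)) ≤ suc j * length good)

module Submission where

-- Proof (first moment + union bound, all probabilities as explicit counts).
-- Fix the scale r ≈ k^(1/8)/8 of k.  For one assignment σ, weight a satisfied
-- literal by b + 2 and a falsified one by b (b + 1 = 32 r); a heavy clause has
-- weight at least 2^(3 gain r) times the mean (b + 1)^k, so by the product
-- formula heavy clauses are a 2^-(3 gain r) fraction of all literal sequences,
-- hence (for n ≥ 2k^2) a 1/(6 P) fraction of the clauses, P = 2^(fracExp r).
-- Weighting formulas by 4^(number of heavy clauses) then shows that more than
-- b0 = ⌊m/P⌋ heavy clauses occur in at most a 2^-(b0+1) ≤ 4^-n fraction of
-- the formulas.  A union bound over the 2^n assignments leaves a j/(j+1)
-- majority of formulas in which every assignment has at most b0 ≤ m/P heavy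
-- clauses, i.e. a heavy fraction at most 2^-(fracExp r) ≤ 2^-(k^(3/4)/100).

open import Data.Nat
open import Data.Nat.Properties
open import Data.Nat.DivMod using (m/n*n≤m; m≡m%n+[m/n]*n; m%n<n; m*n/n≡m; /-monoˡ-≤)
open import Data.Nat.Tactic.RingSolver using (solve-∀)
open import Data.Bool using (Bool; true; false; T; _∧_; not; if_then_else_) renaming (_≟_ to _≟ᵇ_)
open import Data.Bool.Properties using (T-∧; T-≡)
open import Data.Bool.ListAction using (all)
open import Data.Fin using (Fin; zero; suc) renaming (_≟_ to _≟ᶠ_)
open import Data.List using (List; []; _∷_; _++_; map; concatMap; filter; length; allFin)
open import Data.List.Properties using (length-tabulate; map-tabulate)
open import Data.List.Membership.Propositional using (_∈_)
open import Data.List.Membership.Propositional.Properties using (∈-map⁺; ∈-concatMap⁺)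
open import Data.List.Relation.Unary.Any using (here; there)
import Data.List.Relation.Unary.Any as Any
open import Data.List.Relation.Unary.All using (All)
import Data.List.Relation.Unary.All as All
open import Data.List.Relation.Unary.All.Properties using (all-filter; all⁺)
open import Data.List.Relation.Binary.Sublist.Propositional using (_⊆_)
open import Data.List.Relation.Binary.Sublist.Propositional.Properties using (filter-⊆)
import Data.Vec
open import Data.Vec using (Vec; []; _∷_; lookup; tabulate; toList)
open import Data.Vec.Properties using (lookup∘tabulate)
open import Data.Product using (_×_; _,_; proj₁; proj₂; ∃; Σ)
open import Data.Empty using (⊥-elim)
open import Function.Base using (case_of_)
open import Function.Bundles using (Equivalence)
open import Relation.Nullary using (yes; no; does; contradiction)
open import Relation.Binary.PropositionalEquality
open import Defs

^-distribʳ-* : ∀ x y n → (x * y) ^ n ≡ x ^ n * y ^ n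
^-distribʳ-* x y zero    = refl
^-distribʳ-* x y (suc n) rewrite ^-distribʳ-* x y n = interchange x y (x ^ n) (y ^ n)
  where interchange : ∀ x y X Y → x * y * (X * Y) ≡ x * X * (y * Y)
        interchange = solve-∀

bernoulli-upper : ∀ a c j → (a + c) ^ suc j ≤ a ^ j * (a + c) + j * c * (a + c) ^ j
bernoulli-upper a c zero = ≤-reflexive (base a c)
  where base : ∀ a c → (a + c) * 1 ≡ 1 * (a + c) + 0 * c * 1
        base = solve-∀
bernoulli-upper a c (suc j) = begin
    (a + c) * (a + c) ^ suc j
  ≤⟨ *-monoʳ-≤ (a + c) (bernoulli-upper a c j) ⟩
    (a + c) * (a ^ j * (a + c) + j * c * (a + c) ^ j)
  ≡⟨ expand a c (a ^ j) ((a + c) ^ j) j ⟩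
    a * a ^ j * (a + c) + j * c * ((a + c) * (a + c) ^ j) + c * (a ^ j * (a + c))
  ≤⟨ +-monoʳ-≤ (a * a ^ j * (a + c) + j * c * ((a + c) * (a + c) ^ j)) (*-monoʳ-≤ c aʲ[a+c]≤[a+c]ʲ⁺¹) ⟩
    a * a ^ j * (a + c) + j * c * ((a + c) * (a + c) ^ j) + c * ((a + c) * (a + c) ^ j)
  ≡⟨ collect a c (a ^ j) ((a + c) * (a + c) ^ j) j ⟩
    a * a ^ j * (a + c) + suc j * c * ((a + c) * (a + c) ^ j)
  ∎
  where
  open ≤-Reasoning
  aʲ[a+c]≤[a+c]ʲ⁺¹ : a ^ j * (a + c) ≤ (a + c) * (a + c) ^ j
  aʲ[a+c]≤[a+c]ʲ⁺¹ = ≤-trans (*-monoˡ-≤ (a + c) (^-monoˡ-≤ j (m≤m+n a c))) (≤-reflexive (*-comm _ (a + c)))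
  expand : ∀ a c X Y j → (a + c) * (X * (a + c) + j * c * Y) ≡ a * X * (a + c) + j * c * ((a + c) * Y) + c * (X * (a + c))
  expand = solve-∀
  collect : ∀ a c X Z j → a * X * (a + c) + j * c * Z + c * Z ≡ a * X * (a + c) + (1 + j) * c * Z
  collect = solve-∀

perturbed-power≤double : ∀ a c j → 0 < a + c → 2 * j * c ≤ a + c → (a + c) ^ j ≤ 2 * a ^ j
perturbed-power≤double a c j pos 2jc≤a+c =
  *-cancelʳ-≤ ((a + c) ^ j) (2 * a ^ j) (a + c) {{>-nonZero pos}} (+-cancelʳ-≤ (Y * Z) (Y * Z) (2 * X * Z) (begin
    Y * Z + Y * Z                ≡⟨ double Y Z ⟩
    2 * (Z * Y)                  ≤⟨ *-monoʳ-≤ 2 (bernoulli-upper a c j) ⟩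
    2 * (X * Z + j * c * Y)      ≡⟨ distribute X Z j c Y ⟩
    2 * X * Z + (2 * j * c) * Y  ≤⟨ +-monoʳ-≤ (2 * X * Z) (*-monoˡ-≤ Y 2jc≤a+c) ⟩
    2 * X * Z + Z * Y            ≡⟨ cong (2 * X * Z +_) (*-comm Z Y) ⟩
    2 * X * Z + Y * Z            ∎))
  where
  open ≤-Reasoning
  X : ℕ
  X = a ^ j
  Z : ℕ
  Z = a + c
  Y : ℕ
  Y = Z ^ j
  double : ∀ Y Z → Y * Z + Y * Z ≡ 2 * (Z * Y)
  double = solve-∀
  distribute : ∀ X Z j c Y → 2 * (X * Z + j * c * Y) ≡ 2 * X * Z + (2 * j * c) * Y
  distribute = solve-∀

bernoulli-lower : ∀ a c j → a ^ suc j + j * c * a ^ j ≤ a * (a + c) ^ j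
bernoulli-lower a c zero = ≤-reflexive (base a c)
  where base : ∀ a c → a * 1 + 0 * c * 1 ≡ a * 1
        base = solve-∀
bernoulli-lower a c (suc j) = begin
    a * (a * a ^ j) + suc j * c * (a * a ^ j)
  ≤⟨ m≤m+n _ (j * c * c * a ^ j) ⟩
    a * (a * a ^ j) + suc j * c * (a * a ^ j) + j * c * c * a ^ j
  ≡⟨ factor a c (a ^ j) j ⟩
    (a + c) * (a * a ^ j + j * c * a ^ j)
  ≤⟨ *-monoʳ-≤ (a + c) (bernoulli-lower a c j) ⟩
    (a + c) * (a * (a + c) ^ j)
  ≡⟨ *-comm-middle a c ((a + c) ^ j) ⟩
    a * ((a + c) * (a + c) ^ j)
  ∎
  where
  open ≤-Reasoning
  factor : ∀ a c X j → a * (a * X) + (1 + j) * c * (a * X) + j * c * c * X ≡ (a + c) * (a * X + j * c * X)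
  factor = solve-∀
  *-comm-middle : ∀ a c Y → (a + c) * (a * Y) ≡ a * ((a + c) * Y)
  *-comm-middle = solve-∀

twice-power≤succ-power : ∀ B → 0 < B → 2 * B ^ B ≤ (B + 1) ^ B
twice-power≤succ-power B pos = *-cancelˡ-≤ B {{>-nonZero pos}} (begin
    B * (2 * B ^ B)             ≡⟨ split B (B ^ B) ⟩
    B * B ^ B + B * 1 * B ^ B   ≤⟨ bernoulli-lower B 1 B ⟩
    B * (B + 1) ^ B             ∎)
  where
  open ≤-Reasoning
  split : ∀ B X → B * (2 * X) ≡ B * X + B * 1 * X
  split = solve-∀

power-block : ∀ x y c M u → x ^ M ≤ c * y ^ M → x ^ (u * M) ≤ c ^ u * y ^ (u * M)
power-block x y c M u h = begin
  x ^ (u * M)          ≡⟨ cong (x ^_) (*-comm u M) ⟩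
  x ^ (M * u)          ≡⟨ sym (^-*-assoc x M u) ⟩
  (x ^ M) ^ u          ≤⟨ ^-monoˡ-≤ u h ⟩
  (c * y ^ M) ^ u      ≡⟨ ^-distribʳ-* c (y ^ M) u ⟩
  c ^ u * (y ^ M) ^ u  ≡⟨ cong (c ^ u *_) (trans (^-*-assoc y M u) (cong (y ^_) (*-comm M u))) ⟩
  c ^ u * y ^ (u * M)  ∎
  where open ≤-Reasoning

power-block⁻ : ∀ x y c M u → c * y ^ M ≤ x ^ M → c ^ u * y ^ (u * M) ≤ x ^ (u * M)
power-block⁻ x y c M u h = begin
  c ^ u * y ^ (u * M)  ≡⟨ cong (c ^ u *_) (trans (cong (y ^_) (*-comm u M)) (sym (^-*-assoc y M u))) ⟩
  c ^ u * (y ^ M) ^ u  ≡⟨ sym (^-distribʳ-* c (y ^ M) u) ⟩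
  (c * y ^ M) ^ u      ≤⟨ ^-monoˡ-≤ u h ⟩
  (x ^ M) ^ u          ≡⟨ trans (^-*-assoc x M u) (cong (x ^_) (*-comm M u)) ⟩
  x ^ (u * M)          ∎
  where open ≤-Reasoning

-- Exponents below a multiple of M: if x^M ≤ c * y^M with y ≤ x, the same ratio
-- bound c^u holds for every exponent m ≤ u * M (the missing factor y^t ≤ x^t
-- is cancelled).
ratio-bound-below : ∀ x y c M u m → 0 < y → y ≤ x → x ^ M ≤ c * y ^ M → m ≤ u * M →
                    x ^ m ≤ c ^ u * y ^ m
ratio-bound-below x y c M u m y>0 y≤x h m≤uM =
  *-cancelʳ-≤ (x ^ m) (c ^ u * y ^ m) (y ^ t) {{m^n≢0 y t {{>-nonZero y>0}}}} (begin
    x ^ m * y ^ t              ≤⟨ *-monoʳ-≤ (x ^ m) (^-monoˡ-≤ t y≤x) ⟩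
    x ^ m * x ^ t              ≡⟨ sym (^-distribˡ-+-* x m t) ⟩
    x ^ (m + t)                ≡⟨ cong (x ^_) m+t≡uM ⟩
    x ^ (u * M)                ≤⟨ power-block x y c M u h ⟩
    c ^ u * y ^ (u * M)        ≡⟨ cong (λ z → c ^ u * y ^ z) (sym m+t≡uM) ⟩
    c ^ u * y ^ (m + t)        ≡⟨ cong (c ^ u *_) (^-distribˡ-+-* y m t) ⟩
    c ^ u * (y ^ m * y ^ t)    ≡⟨ sym (*-assoc (c ^ u) (y ^ m) (y ^ t)) ⟩
    c ^ u * y ^ m * y ^ t      ∎)
  where
  open ≤-Reasoning
  t : ℕ
  t = u * M ∸ m
  m+t≡uM : m + t ≡ u * M
  m+t≡uM = m+[n∸m]≡n m≤uM

ratio-bound-above : ∀ x y c M u d → y ≤ x → c * y ^ M ≤ x ^ M → u * M ≤ d →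
                    c ^ u * y ^ d ≤ x ^ d
ratio-bound-above x y c M u d y≤x h uM≤d = begin
    c ^ u * y ^ d                ≡⟨ cong (λ z → c ^ u * y ^ z) (sym uM+t≡d) ⟩
    c ^ u * y ^ (u * M + t)      ≡⟨ cong (c ^ u *_) (^-distribˡ-+-* y (u * M) t) ⟩
    c ^ u * (y ^ (u * M) * y ^ t) ≡⟨ sym (*-assoc (c ^ u) _ _) ⟩
    c ^ u * y ^ (u * M) * y ^ t  ≤⟨ *-mono-≤ (power-block⁻ x y c M u h) (^-monoˡ-≤ t y≤x) ⟩
    x ^ (u * M) * x ^ t          ≡⟨ sym (^-distribˡ-+-* x (u * M) t) ⟩
    x ^ (u * M + t)              ≡⟨ cong (x ^_) uM+t≡d ⟩
    x ^ d                        ∎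
  where
  open ≤-Reasoning
  t : ℕ
  t = d ∸ u * M
  uM+t≡d : u * M + t ≡ d
  uM+t≡d = m+[n∸m]≡n uM≤d

-- The exponent gained by the exponential-moment argument at scale r.
gain : ℕ → ℕ
gain r = 2 ^ 15 * r ^ 6

-- The two numerical coincidences fixing the choice of gain r, for j = 512 r^2
-- and b + 1 = 32 r:  (8r)^8 = gain r * j  and  4 * gain r * (b + 1) = 2 (8r)^7.
scale⁸-identity : ∀ r → (8 * r) ^ 8 ≡ gain r * (512 * r * r)
scale⁸-identity r = begin
  (8 * r) ^ 8                       ≡⟨ ^-distribʳ-* 8 r 8 ⟩
  8 ^ 8 * r ^ 8                     ≡⟨ cong₂ _*_ 8⁸-factored r⁸-split ⟩
  (2 ^ 15 * 512) * (r ^ 6 * (r * r)) ≡⟨ rearrange (2 ^ 15) 512 (r ^ 6) r ⟩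
  gain r * (512 * r * r)            ∎
  where
  open ≡-Reasoning
  8⁸-factored : 8 ^ 8 ≡ 2 ^ 15 * 512
  8⁸-factored = refl
  r⁸-split : r ^ 8 ≡ r ^ 6 * (r * r)
  r⁸-split = trans (^-distribˡ-+-* r 6 2) (cong (λ x → r ^ 6 * (r * x)) (*-identityʳ r))
  rearrange : ∀ a c R r → (a * c) * (R * (r * r)) ≡ a * R * (c * r * r)
  rearrange = solve-∀

scale⁷-identity : ∀ r → 4 * gain r * (32 * r) ≡ 2 * (8 * r) ^ 7
scale⁷-identity r = begin
  4 * gain r * (32 * r)                ≡⟨ rearrange 32 (2 ^ 15) (r ^ 6) r ⟩
  2 * ((2 * 2 ^ 15 * 32) * (r * r ^ 6)) ≡⟨ cong (2 *_) (sym (^-distribʳ-* 8 r 7)) ⟩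
  2 * (8 * r) ^ 7                      ∎
  where
  open ≡-Reasoning
  rearrange : ∀ c a R r → 4 * (a * R) * (c * r) ≡ 2 * ((2 * a * c) * (r * R))
  rearrange = solve-∀


-- A balanced pair (one satisfied, one falsified literal) has weight
-- (b+2) b = (b+1)^2 - 1; over e ≤ Q j pairs, with 2 j ≤ (b+1)^2, this loses at
-- most a factor 2^Q against the mean (b+1)^2 per pair.
balanced-pairs-loss : ∀ b j Q e → 0 < b → 2 * j ≤ (b + 1) * (b + 1) → e ≤ Q * j →
                      ((b + 1) * (b + 1)) ^ e ≤ 2 ^ Q * ((b + 2) * b) ^ e
balanced-pairs-loss b j Q e b>0 2j≤[b+1]² e≤Qj =
  ratio-bound-below ((b + 1) * (b + 1)) A 2 j Q e (*-mono-< (≤-trans (s≤s z≤n) (m≤n+m 2 b)) b>0)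
    (subst (A ≤_) A+1≡[b+1]² (m≤m+n A 1)) block e≤Qj
  where
  A : ℕ
  A = (b + 2) * b
  A+1≡[b+1]² : A + 1 ≡ (b + 1) * (b + 1)
  A+1≡[b+1]² = square b
    where square : ∀ b → (b + 2) * b + 1 ≡ (b + 1) * (b + 1)
          square = solve-∀
  block : ((b + 1) * (b + 1)) ^ j ≤ 2 * A ^ j
  block = subst (λ z → z ^ j ≤ 2 * A ^ j) A+1≡[b+1]²
    (perturbed-power≤double A 1 j (m≤n+m 1 A)
      (≤-trans (≤-reflexive (*-identityʳ (2 * j))) (subst (2 * j ≤_) (sym A+1≡[b+1]²) 2j≤[b+1]²)))

-- d ≥ 4 Q (b+1) surplus satisfied literals, of weight b + 2 each, gain a
-- factor 2^(4Q) over the mean weight b + 1, since (1 + 1/(b+1))^(b+1) ≥ 2.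
surplus-gain : ∀ b Q d → 4 * Q * (b + 1) ≤ d → 2 ^ (4 * Q) * (b + 1) ^ d ≤ (b + 2) ^ d
surplus-gain b Q d surplus = ratio-bound-above (b + 2) (b + 1) 2 (b + 1) (4 * Q) d (+-monoʳ-≤ b (s≤s z≤n))
  (subst (λ z → 2 * (b + 1) ^ (b + 1) ≤ z ^ (b + 1)) (+-assoc b 1 1) (twice-power≤succ-power (b + 1) (m≤n+m 1 b)))
  surplus

-- Weight each satisfied literal by
-- b + 2 and each falsified one by b, against the mean weight b + 1.  A clause
-- with e falsified and e + d satisfied literals splits into e balanced pairs
-- (losing at most 2^Q) and d surplus literals (gaining 2^(4Q)): net gain 2^(3Q).
tilted-weight-gain : ∀ b j Q e d → 0 < b → 2 * j ≤ (b + 1) * (b + 1) → e ≤ Q * j →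
                     4 * Q * (b + 1) ≤ d → (b + 1) ^ (e + d + e) * 2 ^ (3 * Q) ≤ (b + 2) ^ (e + d) * b ^ e
tilted-weight-gain b j Q e d b>0 2j≤[b+1]² e≤Qj surplus =
  *-cancelˡ-≤ (2 ^ Q) {{m^n≢0 2 Q}} (begin
     2 ^ Q * ((b + 1) ^ (e + d + e) * 2 ^ (3 * Q))
   ≡⟨ cong (λ z → 2 ^ Q * (z * 2 ^ (3 * Q))) (trans (^-distribˡ-+-* (b + 1) (e + d) e)
        (cong (_* (b + 1) ^ e) (^-distribˡ-+-* (b + 1) e d))) ⟩
     2 ^ Q * ((b + 1) ^ e * (b + 1) ^ d * (b + 1) ^ e * 2 ^ (3 * Q))
   ≡⟨ regroup (2 ^ Q) ((b + 1) ^ e) ((b + 1) ^ d) (2 ^ (3 * Q)) ⟩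
     ((b + 1) ^ e * (b + 1) ^ e) * ((2 ^ Q * 2 ^ (3 * Q)) * (b + 1) ^ d)
   ≡⟨ cong₂ _*_ (sym (^-distribʳ-* (b + 1) (b + 1) e))
        (cong (_* (b + 1) ^ d) (trans (sym (^-distribˡ-+-* 2 Q (3 * Q))) (cong (2 ^_) (Q+3Q Q)))) ⟩
     ((b + 1) * (b + 1)) ^ e * (2 ^ (4 * Q) * (b + 1) ^ d)
   ≤⟨ *-mono-≤ (balanced-pairs-loss b j Q e b>0 2j≤[b+1]² e≤Qj) (surplus-gain b Q d surplus) ⟩
     2 ^ Q * ((b + 2) * b) ^ e * (b + 2) ^ d
   ≡⟨ cong (λ z → 2 ^ Q * z * (b + 2) ^ d) (^-distribʳ-* (b + 2) b e) ⟩
     2 ^ Q * ((b + 2) ^ e * b ^ e) * (b + 2) ^ d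
   ≡⟨ regroup′ (2 ^ Q) ((b + 2) ^ e) (b ^ e) ((b + 2) ^ d) ⟩
     2 ^ Q * ((b + 2) ^ e * (b + 2) ^ d * b ^ e)
   ≡⟨ cong (λ z → 2 ^ Q * (z * b ^ e)) (sym (^-distribˡ-+-* (b + 2) e d)) ⟩
     2 ^ Q * ((b + 2) ^ (e + d) * b ^ e)
   ∎)
  where
  open ≤-Reasoning
  regroup : ∀ G X Y H → G * (X * Y * X * H) ≡ (X * X) * ((G * H) * Y)
  regroup = solve-∀
  Q+3Q : ∀ Q → Q + 3 * Q ≡ 4 * Q
  Q+3Q = solve-∀
  regroup′ : ∀ G Z W V → G * (Z * W) * V ≡ G * (Z * V * W)
  regroup′ = solve-∀

heavy-surplus : ∀ R k s e → s + e ≡ k → R ^ 8 ≤ k → heavy k s ≡ true → e ≤ s × 2 * R ^ 7 < s ∸ e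
heavy-surplus R k s e s+e≡k R⁸≤k hv = e≤s , surplus-large
  where
  open ≤-Reasoning
  double : ∀ x → 2 * x ≡ x + x
  double = solve-∀
  parts : T (k <ᵇ 2 * s) × T (2 ^ 8 * k ^ 7 <ᵇ (2 * s ∸ k) ^ 8)
  parts = Equivalence.to T-∧ (Equivalence.from T-≡ hv)
  k<2s : k < 2 * s
  k<2s = <ᵇ⇒< k (2 * s) (proj₁ parts)
  excess⁸-large : 2 ^ 8 * k ^ 7 < (2 * s ∸ k) ^ 8
  excess⁸-large = <ᵇ⇒< _ _ (proj₂ parts)
  e≤s : e ≤ s
  e≤s = <⇒≤ (+-cancelˡ-< s e s (subst₂ _<_ (sym s+e≡k) (double s) k<2s))
  2s∸k≡s∸e : 2 * s ∸ k ≡ s ∸ e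
  2s∸k≡s∸e = trans (cong₂ _∸_ (double s) (sym s+e≡k)) ([m+n]∸[m+o]≡n∸o s s e)
  surplus-large : 2 * R ^ 7 < s ∸ e
  surplus-large with s ∸ e ≤? 2 * R ^ 7
  ... | no s∸e≰ = ≰⇒> s∸e≰
  ... | yes s∸e≤ = ⊥-elim (<⇒≱ excess⁸-large (begin
    (2 * s ∸ k) ^ 8     ≡⟨ cong (_^ 8) 2s∸k≡s∸e ⟩
    (s ∸ e) ^ 8         ≤⟨ ^-monoˡ-≤ 8 s∸e≤ ⟩
    (2 * R ^ 7) ^ 8     ≡⟨ ^-distribʳ-* 2 (R ^ 7) 8 ⟩
    2 ^ 8 * (R ^ 7) ^ 8 ≡⟨ cong (2 ^ 8 *_) (trans (^-*-assoc R 7 8) (sym (^-*-assoc R 8 7))) ⟩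
    2 ^ 8 * (R ^ 8) ^ 7 ≤⟨ *-monoʳ-≤ (2 ^ 8) (^-monoˡ-≤ 7 R⁸≤k) ⟩
    2 ^ 8 * k ^ 7       ∎))

-- The tilt parameter at scale r, chosen so that the mean weight b + 1 is 32 r.
tilt : ℕ → ℕ
tilt r = 32 * r ∸ 1

tilt+1≡32r : ∀ r → 1 ≤ r → tilt r + 1 ≡ 32 * r
tilt+1≡32r r r≥1 = m∸n+n≡m (≤-trans (s≤s z≤n) (*-monoʳ-≤ 32 r≥1))

tilt>0 : ∀ r → 1 ≤ r → 0 < tilt r
tilt>0 r r≥1 = +-cancelʳ-< 1 0 (tilt r)
  (subst (1 <_) (sym (tilt+1≡32r r r≥1)) (≤-trans (s≤s (s≤s z≤n)) (*-monoʳ-≤ 32 r≥1)))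

tilt-square : ∀ r → 1 ≤ r → 2 * (512 * r * r) ≤ (tilt r + 1) * (tilt r + 1)
tilt-square r r≥1 = ≤-reflexive (begin
  2 * (512 * r * r)            ≡⟨ regroup 2 512 r ⟩
  (2 * 512) * (r * r)          ≡⟨⟩
  (32 * 32) * (r * r)          ≡⟨ interchange 32 r ⟩
  32 * r * (32 * r)            ≡⟨ sym (cong₂ _*_ (tilt+1≡32r r r≥1) (tilt+1≡32r r r≥1)) ⟩
  (tilt r + 1) * (tilt r + 1)  ∎)
  where
  open ≡-Reasoning
  regroup : ∀ a c r → a * (c * r * r) ≡ (a * c) * (r * r)
  regroup = solve-∀
  interchange : ∀ c r → (c * c) * (r * r) ≡ c * r * (c * r)
  interchange = solve-∀

minority≤half : ∀ s e k X → e ≤ s → s + e ≡ k → k ≤ 2 * X → e ≤ X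
minority≤half s e k X e≤s s+e≡k k≤2X = *-cancelˡ-≤ 2 (begin
  2 * e   ≡⟨ double e ⟩
  e + e   ≤⟨ +-monoˡ-≤ e e≤s ⟩
  s + e   ≡⟨ s+e≡k ⟩
  k       ≤⟨ k≤2X ⟩
  2 * X   ∎)
  where
  open ≤-Reasoning
  double : ∀ x → 2 * x ≡ x + x
  double = solve-∀

heavy-clause-gain : ∀ r k s e → 1 ≤ r → s + e ≡ k → (8 * r) ^ 8 ≤ k → k ≤ 2 * (8 * r) ^ 8 →
  heavy k s ≡ true → (tilt r + 1) ^ k * 2 ^ (3 * gain r) ≤ (tilt r + 2) ^ s * tilt r ^ e
heavy-clause-gain r k s e r≥1 s+e≡k lo hi hv =
  subst₂ (λ k′ s′ → (b + 1) ^ k′ * 2 ^ (3 * gain r) ≤ (b + 2) ^ s′ * b ^ e) e+d+e≡k e+d≡s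
    (tilted-weight-gain b j (gain r) e d (tilt>0 r r≥1) (tilt-square r r≥1) e≤Qj 4Q[b+1]≤d)
  where
  b : ℕ
  b = tilt r
  j : ℕ
  j = 512 * r * r
  d : ℕ
  d = s ∸ e
  decoded : e ≤ s × 2 * (8 * r) ^ 7 < s ∸ e
  decoded = heavy-surplus (8 * r) k s e s+e≡k lo hv
  e+d≡s : e + d ≡ s
  e+d≡s = m+[n∸m]≡n (proj₁ decoded)
  e+d+e≡k : e + d + e ≡ k
  e+d+e≡k = trans (cong (_+ e) e+d≡s) s+e≡k
  e≤Qj : e ≤ gain r * j
  e≤Qj = minority≤half s e k (gain r * j) (proj₁ decoded) s+e≡k (subst (λ z → k ≤ 2 * z) (scale⁸-identity r) hi)
  4Q[b+1]≤d : 4 * gain r * (b + 1) ≤ d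
  4Q[b+1]≤d = ≤-trans (≤-reflexive (trans (cong (4 * gain r *_) (tilt+1≡32r r r≥1)) (scale⁷-identity r)))
                      (<⇒≤ (proj₂ decoded))

sumBy : {A : Set} → (A → ℕ) → List A → ℕ
sumBy f []       = 0
sumBy f (x ∷ xs) = f x + sumBy f xs

countBy : {A : Set} → (A → Bool) → List A → ℕ
countBy p = sumBy (λ x → if p x then 1 else 0)

module _ {A : Set} where
  sumBy-++ : ∀ (f : A → ℕ) xs ys → sumBy f (xs ++ ys) ≡ sumBy f xs + sumBy f ys
  sumBy-++ f []       ys = refl
  sumBy-++ f (x ∷ xs) ys = trans (cong (f x +_) (sumBy-++ f xs ys)) (sym (+-assoc (f x) _ _))

  sumBy-mono : ∀ (f g : A → ℕ) xs → (∀ x → f x ≤ g x) → sumBy f xs ≤ sumBy g xs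
  sumBy-mono f g []       f≤g = z≤n
  sumBy-mono f g (x ∷ xs) f≤g = +-mono-≤ (f≤g x) (sumBy-mono f g xs f≤g)

  sumBy-cong : ∀ (f g : A → ℕ) xs → (∀ x → f x ≡ g x) → sumBy f xs ≡ sumBy g xs
  sumBy-cong f g []       f≡g = refl
  sumBy-cong f g (x ∷ xs) f≡g = cong₂ _+_ (f≡g x) (sumBy-cong f g xs f≡g)

  sumBy-scale : ∀ c (f : A → ℕ) xs → sumBy (λ x → c * f x) xs ≡ c * sumBy f xs
  sumBy-scale c f []       = sym (*-zeroʳ c)
  sumBy-scale c f (x ∷ xs) = trans (cong (c * f x +_) (sumBy-scale c f xs)) (sym (*-distribˡ-+ c (f x) _))

  sumBy-+ : ∀ (f g : A → ℕ) xs → sumBy (λ x → f x + g x) xs ≡ sumBy f xs + sumBy g xs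
  sumBy-+ f g []       = refl
  sumBy-+ f g (x ∷ xs) = trans (cong (f x + g x +_) (sumBy-+ f g xs)) (interchange (f x) (g x) (sumBy f xs) (sumBy g xs))
    where interchange : ∀ a b c d → a + b + (c + d) ≡ a + c + (b + d)
          interchange = solve-∀

  sumBy-const : ∀ c (xs : List A) → sumBy (λ _ → c) xs ≡ length xs * c
  sumBy-const c []       = refl
  sumBy-const c (x ∷ xs) = cong (c +_) (sumBy-const c xs)

  countBy-markov : ∀ (p : A → Bool) (f : A → ℕ) c xs → (∀ x → p x ≡ true → c ≤ f x) → countBy p xs * c ≤ sumBy f xs
  countBy-markov p f c []       h = z≤n
  countBy-markov p f c (x ∷ xs) h with p x in px
  ... | true  = +-mono-≤ (h x px) (countBy-markov p f c xs h)
  ... | false = ≤-trans (countBy-markov p f c xs h) (m≤n+m _ (f x))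

  countBy-mono : ∀ (p q : A → Bool) xs → (∀ x → p x ≡ true → q x ≡ true) → countBy p xs ≤ countBy q xs
  countBy-mono p q xs p⇒q = sumBy-mono _ _ xs indicator-mono
    where indicator-mono : ∀ x → (if p x then 1 else 0) ≤ (if q x then 1 else 0)
          indicator-mono x with p x in px
          ... | false = z≤n
          ... | true rewrite p⇒q x px = ≤-refl

  countBy-weighted : ∀ (p : A → Bool) W xs → sumBy (λ x → if p x then W else 0) xs ≡ countBy p xs * W
  countBy-weighted p W []       = refl
  countBy-weighted p W (x ∷ xs) with p x
  ... | true  = cong (W +_) (countBy-weighted p W xs)
  ... | false = countBy-weighted p W xs

  countBy-false : ∀ (xs : List A) → countBy (λ _ → false) xs ≡ 0
  countBy-false []       = refl
  countBy-false (x ∷ xs) = countBy-false xs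

  countBy-true : ∀ (xs : List A) → countBy (λ _ → true) xs ≡ length xs
  countBy-true []       = refl
  countBy-true (x ∷ xs) = cong suc (countBy-true xs)

  countBy≡length-filter : ∀ (p : A → Bool) xs → countBy p xs ≡ length (filter (λ x → p x ≟ᵇ true) xs)
  countBy≡length-filter p []       = refl
  countBy≡length-filter p (x ∷ xs) with p x
  ... | true  = cong suc (countBy≡length-filter p xs)
  ... | false = countBy≡length-filter p xs

  countBy-filter≤ : ∀ (p q : A → Bool) xs → countBy p (filter (λ x → q x ≟ᵇ true) xs) ≤ countBy p xs
  countBy-filter≤ p q []       = z≤n
  countBy-filter≤ p q (x ∷ xs) with q x
  ... | true  = +-monoʳ-≤ (if p x then 1 else 0) (countBy-filter≤ p q xs)
  ... | false = ≤-trans (countBy-filter≤ p q xs) (m≤n+m _ (if p x then 1 else 0))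

  filter+rejected≡length : ∀ (q : A → Bool) xs → length (filter (λ x → q x ≟ᵇ true) xs) + countBy (λ x → not (q x)) xs ≡ length xs
  filter+rejected≡length q []       = refl
  filter+rejected≡length q (x ∷ xs) with q x
  ... | true  = cong suc (filter+rejected≡length q xs)
  ... | false = trans (+-suc _ _) (cong suc (filter+rejected≡length q xs))

module _ {A B : Set} where
  sumBy-map : ∀ (f : B → ℕ) (g : A → B) xs → sumBy f (map g xs) ≡ sumBy (λ x → f (g x)) xs
  sumBy-map f g []       = refl
  sumBy-map f g (x ∷ xs) = cong (f (g x) +_) (sumBy-map f g xs)

  sumBy-concatMap : ∀ (f : B → ℕ) (g : A → List B) xs → sumBy f (concatMap g xs) ≡ sumBy (λ x → sumBy f (g x)) xs
  sumBy-concatMap f g []       = refl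
  sumBy-concatMap f g (x ∷ xs) = trans (sumBy-++ f (g x) (concatMap g xs)) (cong (sumBy f (g x) +_) (sumBy-concatMap f g xs))

  sumBy-swap : ∀ (g : A → B → ℕ) xs ys → sumBy (λ x → sumBy (g x) ys) xs ≡ sumBy (λ y → sumBy (λ x → g x y) xs) ys
  sumBy-swap g []       ys = sym (trans (sumBy-const 0 ys) (*-zeroʳ (length ys)))
  sumBy-swap g (x ∷ xs) ys = trans (cong (sumBy (g x) ys +_) (sumBy-swap g xs ys)) (sym (sumBy-+ (g x) (λ y → sumBy (λ x → g x y) xs) ys))

prodBy : {A : Set} {k : ℕ} → (A → ℕ) → Vec A k → ℕ
prodBy w []      = 1
prodBy w (x ∷ v) = w x * prodBy w v

sumBy-prodBy-allVecs : {A : Set} (w : A → ℕ) (xs : List A) (k : ℕ) → sumBy (prodBy w) (allVecs xs k) ≡ sumBy w xs ^ k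
sumBy-prodBy-allVecs w xs zero    = refl
sumBy-prodBy-allVecs w xs (suc k) = begin
    sumBy (prodBy w) (concatMap (λ x → map (x ∷_) (allVecs xs k)) xs)
  ≡⟨ sumBy-concatMap (prodBy w) (λ x → map (x ∷_) (allVecs xs k)) xs ⟩
    sumBy (λ x → sumBy (prodBy w) (map (x ∷_) (allVecs xs k))) xs
  ≡⟨ sumBy-cong _ _ xs first-entry ⟩
    sumBy (λ x → sumBy w xs ^ k * w x) xs
  ≡⟨ sumBy-scale (sumBy w xs ^ k) w xs ⟩
    sumBy w xs ^ k * sumBy w xs
  ≡⟨ *-comm _ (sumBy w xs) ⟩
    sumBy w xs * sumBy w xs ^ k
  ∎
  where
  open ≡-Reasoning
  first-entry : ∀ x → sumBy (prodBy w) (map (x ∷_) (allVecs xs k)) ≡ sumBy w xs ^ k * w x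
  first-entry x = begin
    sumBy (prodBy w) (map (x ∷_) (allVecs xs k))  ≡⟨ sumBy-map (prodBy w) (x ∷_) (allVecs xs k) ⟩
    sumBy (λ v → w x * prodBy w v) (allVecs xs k)  ≡⟨ sumBy-scale (w x) (prodBy w) (allVecs xs k) ⟩
    w x * sumBy (prodBy w) (allVecs xs k)          ≡⟨ cong (w x *_) (sumBy-prodBy-allVecs w xs k) ⟩
    w x * sumBy w xs ^ k                           ≡⟨ *-comm (w x) _ ⟩
    sumBy w xs ^ k * w x                           ∎

length-allVecs : {A : Set} (xs : List A) (k : ℕ) → length (allVecs xs k) ≡ length xs ^ k
length-allVecs xs k = begin
  length (allVecs xs k)               ≡⟨ sym (countBy-true (allVecs xs k)) ⟩
  sumBy (λ _ → 1) (allVecs xs k)      ≡⟨ sumBy-cong _ _ (allVecs xs k) (λ v → sym (unit-product v)) ⟩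
  sumBy (prodBy (λ _ → 1)) (allVecs xs k) ≡⟨ sumBy-prodBy-allVecs (λ _ → 1) xs k ⟩
  sumBy (λ _ → 1) xs ^ k              ≡⟨ cong (_^ k) (countBy-true xs) ⟩
  length xs ^ k                       ∎
  where
  open ≡-Reasoning
  unit-product : ∀ {m} (v : Vec _ m) → prodBy (λ _ → 1) v ≡ 1
  unit-product []      = refl
  unit-product (x ∷ v) = trans (+-identityʳ _) (unit-product v)

numUnsat : {n k : ℕ} → Assignment n → Clause n k → ℕ
numUnsat σ []       = 0
numUnsat σ (l ∷ ls) = (if litSat σ l then 0 else 1) + numUnsat σ ls

numSat+numUnsat : ∀ {n k} (σ : Assignment n) (c : Clause n k) → numSat σ c + numUnsat σ c ≡ k
numSat+numUnsat σ []       = refl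
numSat+numUnsat σ (l ∷ ls) with litSat σ l
... | true  = cong suc (numSat+numUnsat σ ls)
... | false = trans (+-suc _ _) (cong suc (numSat+numUnsat σ ls))

tilted-weight : ∀ {n} (σ : Assignment n) y z → Lit n → ℕ
tilted-weight σ y z l = if litSat σ l then y else z

prodBy-tilted-weight : ∀ {n k} (σ : Assignment n) y z (c : Clause n k) →
  prodBy (tilted-weight σ y z) c ≡ y ^ numSat σ c * z ^ numUnsat σ c
prodBy-tilted-weight σ y z []       = refl
prodBy-tilted-weight σ y z (l ∷ ls) with litSat σ l
... | true  = trans (cong (y *_) (prodBy-tilted-weight σ y z ls)) (sym (*-assoc y _ _))
... | false = trans (cong (z *_) (prodBy-tilted-weight σ y z ls)) (swap z (y ^ numSat σ ls) (z ^ numUnsat σ ls))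
  where swap : ∀ z a b → z * (a * b) ≡ a * (z * b)
        swap = solve-∀

-- Each variable contributes one satisfied and one falsified literal.
sumBy-tilted-weight : ∀ {n} (σ : Assignment n) y z → sumBy (tilted-weight σ y z) (allLits n) ≡ n * (y + z)
sumBy-tilted-weight {n} σ y z = begin
    sumBy (tilted-weight σ y z) (allLits n)
  ≡⟨ sumBy-concatMap (tilted-weight σ y z) (λ i → (i , true) ∷ (i , false) ∷ []) (allFin n) ⟩
    sumBy (λ i → tilted-weight σ y z (i , true) + (tilted-weight σ y z (i , false) + 0)) (allFin n)
  ≡⟨ sumBy-cong _ _ (allFin n) both-signs ⟩
    sumBy (λ _ → y + z) (allFin n)
  ≡⟨ sumBy-const (y + z) (allFin n) ⟩
    length (allFin n) * (y + z)
  ≡⟨ cong (_* (y + z)) (length-tabulate {n = n} (λ i → i)) ⟩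
    n * (y + z)
  ∎
  where
  open ≡-Reasoning
  both-signs : ∀ i → tilted-weight σ y z (i , true) + (tilted-weight σ y z (i , false) + 0) ≡ y + z
  both-signs i with σ i
  ... | true  = cong (y +_) (+-identityʳ z)
  ... | false = trans (cong (z +_) (+-identityʳ y)) (+-comm z y)

heavyClause : {n : ℕ} (k : ℕ) → Assignment n → Clause n k → Bool
heavyClause k σ c = heavy k (numSat σ c)

heavy-sequences-rare : ∀ n k b G (σ : Assignment n) →
  (∀ s e → s + e ≡ k → heavy k s ≡ true → (b + 1) ^ k * G ≤ (b + 2) ^ s * b ^ e) →
  countBy (heavyClause k σ) (allVecs (allLits n) k) * G ≤ (2 * n) ^ k
heavy-sequences-rare n k b G σ gain-on-heavy =
  *-cancelʳ-≤ _ _ ((b + 1) ^ k) {{m^n≢0 (b + 1) k {{>-nonZero (m≤n+m 1 b)}}}} (begin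
    H * G * (b + 1) ^ k
  ≡⟨ rotate H G ((b + 1) ^ k) ⟩
    H * ((b + 1) ^ k * G)
  ≤⟨ countBy-markov (heavyClause k σ) (prodBy ω) ((b + 1) ^ k * G) (allVecs (allLits n) k) heavy-weight ⟩
    sumBy (prodBy ω) (allVecs (allLits n) k)
  ≡⟨ sumBy-prodBy-allVecs ω (allLits n) k ⟩
    sumBy ω (allLits n) ^ k
  ≡⟨ cong (_^ k) (trans (sumBy-tilted-weight σ (b + 2) b) (mean n b)) ⟩
    (2 * n * (b + 1)) ^ k
  ≡⟨ ^-distribʳ-* (2 * n) (b + 1) k ⟩
    (2 * n) ^ k * (b + 1) ^ k
  ∎)
  where
  open ≤-Reasoning
  H : ℕ
  H = countBy (heavyClause k σ) (allVecs (allLits n) k)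
  ω : Lit n → ℕ
  ω = tilted-weight σ (b + 2) b
  rotate : ∀ a c d → a * c * d ≡ a * (d * c)
  rotate = solve-∀
  mean : ∀ n b → n * (b + 2 + b) ≡ 2 * n * (b + 1)
  mean = solve-∀
  heavy-weight : ∀ c → heavyClause k σ c ≡ true → (b + 1) ^ k * G ≤ prodBy ω c
  heavy-weight c hv = subst ((b + 1) ^ k * G ≤_) (sym (prodBy-tilted-weight σ (b + 2) b c))
    (gain-on-heavy (numSat σ c) (numUnsat σ c) (numSat+numUnsat σ c) hv)

∧-true-split : ∀ {x y} → x ∧ y ≡ true → (x ≡ true) × (y ≡ true)
∧-true-split {true} {true} refl = refl , refl

∧-true-intro : ∀ {x y} → x ≡ true → y ≡ true → x ∧ y ≡ true
∧-true-intro refl refl = refl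

vars : ∀ {n k} → Clause n k → List (Fin n)
vars c = toList (Data.Vec.map proj₁ c)

avoids : ∀ {n} → List (Fin n) → List (Fin n) → Bool
avoids E []       = true
avoids E (i ∷ is) = not (i ∈ᵇ E) ∧ avoids E is

freshFrom : ∀ {n k} → List (Fin n) → Clause n k → Bool
freshFrom E c = distinctᵇ (vars c) ∧ avoids E (vars c)

avoids-cons : ∀ {n} (i : Fin n) E vs → avoids (i ∷ E) vs ≡ true → (i ∈ᵇ vs ≡ false) × (avoids E vs ≡ true)
avoids-cons i E []       h = refl , refl
avoids-cons i E (j ∷ js) h with j ≟ᶠ i | i ≟ᶠ j | ∧-true-split {not (j ∈ᵇ (i ∷ E))} h
... | yes j≡i | _       | () , _
... | no j≢i  | yes i≡j | _ = ⊥-elim (j≢i (sym i≡j))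
... | no _    | no _    | j∉E , rest =
  proj₁ (avoids-cons i E js rest) , ∧-true-intro j∉E (proj₂ (avoids-cons i E js rest))

freshFrom-cons : ∀ {n k} (x : Lit n) E (v : Clause n k) → proj₁ x ∈ᵇ E ≡ false →
                 freshFrom (proj₁ x ∷ E) v ≡ true → freshFrom E (x ∷ v) ≡ true
freshFrom-cons x E v x∉E fresh with ∧-true-split fresh
... | distinct , avoid with avoids-cons (proj₁ x) E (vars v) avoid
...   | x∉v , v-avoids = ∧-true-intro (∧-true-intro (cong not x∉v) distinct) (∧-true-intro (cong not x∉E) v-avoids)

count-equal≤1 : ∀ n (e : Fin n) → countBy (λ i → does (i ≟ᶠ e)) (allFin n) ≤ 1
count-equal≤1 (suc n) zero    = s≤s (≤-reflexive (trans
  (cong (countBy (λ i → does (i ≟ᶠ zero))) (sym (map-tabulate (λ i → i) (suc {n}))))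
  (trans (sumBy-map _ (suc {n}) (allFin n)) (countBy-false (allFin n)))))
count-equal≤1 (suc n) (suc e) = ≤-trans (≤-reflexive (trans
  (cong (countBy (λ i → does (i ≟ᶠ suc e))) (sym (map-tabulate (λ i → i) (suc {n}))))
  (sumBy-map _ (suc {n}) (allFin n)))) (count-equal≤1 n e)

count-outside : ∀ n (E : List (Fin n)) → n ≤ countBy (λ i → not (i ∈ᵇ E)) (allFin n) + length E
count-outside n []      = ≤-reflexive (trans (sym (length-tabulate {n = n} (λ i → i)))
                            (trans (sym (countBy-true (allFin n))) (sym (+-identityʳ _))))
count-outside n (e ∷ E) = begin
    n
  ≤⟨ count-outside n E ⟩
    countBy (outside E) (allFin n) + length E
  ≤⟨ +-monoˡ-≤ (length E) (sumBy-mono _ _ (allFin n) indicator-split) ⟩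
    sumBy (λ i → (if outside (e ∷ E) i then 1 else 0) + (if does (i ≟ᶠ e) then 1 else 0)) (allFin n) + length E
  ≡⟨ cong (_+ length E) (sumBy-+ _ _ (allFin n)) ⟩
    countBy (outside (e ∷ E)) (allFin n) + countBy (λ i → does (i ≟ᶠ e)) (allFin n) + length E
  ≤⟨ +-monoˡ-≤ (length E) (+-monoʳ-≤ (countBy (outside (e ∷ E)) (allFin n)) (count-equal≤1 n e)) ⟩
    countBy (outside (e ∷ E)) (allFin n) + 1 + length E
  ≡⟨ +-assoc _ 1 (length E) ⟩
    countBy (outside (e ∷ E)) (allFin n) + suc (length E)
  ∎
  where
  open ≤-Reasoning
  outside : List (Fin n) → Fin n → Bool
  outside E i = not (i ∈ᵇ E)
  indicator≤1 : ∀ b → (if b then 1 else 0) ≤ 1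
  indicator≤1 true  = ≤-refl
  indicator≤1 false = z≤n
  indicator-split : ∀ i → (if outside E i then 1 else 0) ≤
                          (if outside (e ∷ E) i then 1 else 0) + (if does (i ≟ᶠ e) then 1 else 0)
  indicator-split i with i ≟ᶠ e
  ... | yes _ = indicator≤1 (outside E i)
  ... | no _  = m≤m+n _ _

count-lits-outside : ∀ n (E : List (Fin n)) →
  countBy (λ (x : Lit n) → not (proj₁ x ∈ᵇ E)) (allLits n) ≡ 2 * countBy (λ i → not (i ∈ᵇ E)) (allFin n)
count-lits-outside n E = trans (sumBy-concatMap _ (λ i → (i , true) ∷ (i , false) ∷ []) (allFin n))
  (trans (sumBy-cong _ _ (allFin n) (λ i → twice (if not (i ∈ᵇ E) then 1 else 0)))
         (sumBy-scale 2 (λ i → if not (i ∈ᵇ E) then 1 else 0) (allFin n)))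
  where twice : ∀ a → a + (a + 0) ≡ 2 * a
        twice = solve-∀

count-lits-outside≥ : ∀ n (E : List (Fin n)) → 2 * (n ∸ length E) ≤ countBy (λ (x : Lit n) → not (proj₁ x ∈ᵇ E)) (allLits n)
count-lits-outside≥ n E = ≤-trans
  (*-monoʳ-≤ 2 (≤-trans (∸-monoˡ-≤ (length E) (count-outside n E)) (≤-reflexive (m+n∸n≡m _ (length E)))))
  (≤-reflexive (sym (count-lits-outside n E)))

-- Lower bound on clauses fresh from E: choosing the literals one at a time, each
-- has at least 2 (n - |E| - k) admissible choices.
fresh-sequences≥ : ∀ n k (E : List (Fin n)) → (2 * (n ∸ (length E + k))) ^ k ≤ countBy (freshFrom E) (allVecs (allLits n) k)
fresh-sequences≥ n zero    E = ≤-refl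
fresh-sequences≥ n (suc k) E = begin
    2 * (n ∸ (length E + suc k)) * W
  ≤⟨ *-monoˡ-≤ W (*-monoʳ-≤ 2 (∸-monoʳ-≤ n (m≤m+n (length E) (suc k)))) ⟩
    2 * (n ∸ length E) * W
  ≤⟨ *-monoˡ-≤ W (count-lits-outside≥ n E) ⟩
    countBy outsideLit (allLits n) * W
  ≡⟨ sym (countBy-weighted outsideLit W (allLits n)) ⟩
    sumBy (λ x → if outsideLit x then W else 0) (allLits n)
  ≤⟨ sumBy-mono _ _ (allLits n) extensions ⟩
    sumBy (λ x → countBy (freshFrom E) (map (x ∷_) (allVecs (allLits n) k))) (allLits n)
  ≡⟨ sym (sumBy-concatMap _ (λ x → map (x ∷_) (allVecs (allLits n) k)) (allLits n)) ⟩
    countBy (freshFrom E) (allVecs (allLits n) (suc k))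
  ∎
  where
  open ≤-Reasoning
  W : ℕ
  W = (2 * (n ∸ (length E + suc k))) ^ k
  outsideLit : Lit n → Bool
  outsideLit x = not (proj₁ x ∈ᵇ E)
  extensions : ∀ x → (if outsideLit x then W else 0) ≤ countBy (freshFrom E) (map (x ∷_) (allVecs (allLits n) k))
  extensions x with proj₁ x ∈ᵇ E in x∈E
  ... | true  = z≤n
  ... | false = begin
      W
    ≡⟨ cong (λ z → (2 * (n ∸ z)) ^ k) (+-suc (length E) k) ⟩
      (2 * (n ∸ (length (proj₁ x ∷ E) + k))) ^ k
    ≤⟨ fresh-sequences≥ n k (proj₁ x ∷ E) ⟩
      countBy (freshFrom (proj₁ x ∷ E)) (allVecs (allLits n) k)
    ≤⟨ countBy-mono _ _ (allVecs (allLits n) k) (λ v → freshFrom-cons x E v x∈E) ⟩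
      countBy (λ v → freshFrom E (x ∷ v)) (allVecs (allLits n) k)
    ≡⟨ sym (sumBy-map _ (x ∷_) (allVecs (allLits n) k)) ⟩
      countBy (freshFrom E) (map (x ∷_) (allVecs (allLits n) k))
    ∎

allClauses≥ : ∀ n k → (2 * (n ∸ k)) ^ k ≤ length (allClauses n k)
allClauses≥ n k = begin
  (2 * (n ∸ k)) ^ k                                         ≤⟨ fresh-sequences≥ n k [] ⟩
  countBy (freshFrom []) (allVecs (allLits n) k)            ≤⟨ countBy-mono _ _ (allVecs (allLits n) k) (λ c h → proj₁ (∧-true-split h)) ⟩
  countBy (λ c → distinctᵇ (vars c)) (allVecs (allLits n) k) ≡⟨ countBy≡length-filter _ (allVecs (allLits n) k) ⟩
  length (allClauses n k)                                   ∎
  where open ≤-Reasoning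

-- Formula weight 4^(number of heavy clauses): it factorises over the clauses.
heavyClauseWeight : {n : ℕ} (k : ℕ) → Assignment n → Clause n k → ℕ
heavyClauseWeight k σ C = if heavyClause k σ C then 4 else 1

4^numHeavy≡prodBy : ∀ {n k m} (σ : Assignment n) (F : Formula n k m) → 4 ^ numHeavy σ F ≡ prodBy (heavyClauseWeight k σ) F
4^numHeavy≡prodBy σ [] = refl
4^numHeavy≡prodBy {k = k} σ (C ∷ F) with heavyClause k σ C
... | true  = cong (4 *_) (4^numHeavy≡prodBy σ F)
... | false = trans (4^numHeavy≡prodBy σ F) (sym (+-identityʳ _))

sumBy-heavyClauseWeight : ∀ {n k} (σ : Assignment n) (Cs : List (Clause n k)) →
  sumBy (heavyClauseWeight k σ) Cs ≡ length Cs + 3 * countBy (heavyClause k σ) Cs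
sumBy-heavyClauseWeight σ [] = refl
sumBy-heavyClauseWeight {k = k} σ (C ∷ Cs) with heavyClause k σ C
... | true  = trans (cong (4 +_) (sumBy-heavyClauseWeight σ Cs)) (regroup (length Cs) (countBy (heavyClause k σ) Cs))
  where regroup : ∀ a b → 4 + (a + 3 * b) ≡ suc (a + 3 * (1 + b))
        regroup = solve-∀
... | false = cong suc (sumBy-heavyClauseWeight σ Cs)

overloaded : ∀ {n k m} → Assignment n → ℕ → Formula n k m → Bool
overloaded σ b0 F = not (numHeavy σ F ≤ᵇ b0)

overloaded-first-moment : ∀ n k m (σ : Assignment n) b0 →
  countBy (overloaded σ b0) (allFormulas n k m) * 4 ^ suc b0
    ≤ (length (allClauses n k) + 3 * countBy (heavyClause k σ) (allClauses n k)) ^ m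
overloaded-first-moment n k m σ b0 = begin
    countBy (overloaded σ b0) (allFormulas n k m) * 4 ^ suc b0
  ≤⟨ countBy-markov _ (λ F → 4 ^ numHeavy σ F) (4 ^ suc b0) (allFormulas n k m) overloaded-weight ⟩
    sumBy (λ F → 4 ^ numHeavy σ F) (allFormulas n k m)
  ≡⟨ sumBy-cong _ _ (allFormulas n k m) (4^numHeavy≡prodBy σ) ⟩
    sumBy (prodBy (heavyClauseWeight k σ)) (allVecs (allClauses n k) m)
  ≡⟨ sumBy-prodBy-allVecs (heavyClauseWeight k σ) (allClauses n k) m ⟩
    sumBy (heavyClauseWeight k σ) (allClauses n k) ^ m
  ≡⟨ cong (_^ m) (sumBy-heavyClauseWeight σ (allClauses n k)) ⟩
    (length (allClauses n k) + 3 * countBy (heavyClause k σ) (allClauses n k)) ^ m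
  ∎
  where
  open ≤-Reasoning
  overloaded-weight : ∀ F → overloaded σ b0 F ≡ true → 4 ^ suc b0 ≤ 4 ^ numHeavy σ F
  overloaded-weight F h with numHeavy σ F ≤? b0
  ... | yes ≤b0 = contradiction (trans (sym h) (cong not (Equivalence.to T-≡ (≤⇒≤ᵇ ≤b0)))) (λ ())
  ... | no ≰b0  = ^-monoʳ-≤ 4 (≰⇒> ≰b0)

-- If heavy clauses are rare (6 P h ≤ L) and m ≤ (b0+1) P, then for a fixed
-- assignment at most a 2^-(b0+1) fraction of the L^m formulas is overloaded:
-- the first moment (L + 3h)^m is at most 2^(b0+1) L^m, since (L + 3h)^P ≤ 2 L^P.
overloaded-rare : ∀ n k m (σ : Assignment n) b0 P → 0 < length (allClauses n k) →
  6 * P * countBy (heavyClause k σ) (allClauses n k) ≤ length (allClauses n k) → m ≤ suc b0 * P →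
  countBy (overloaded σ b0) (allFormulas n k m) * 2 ^ suc b0 ≤ length (allClauses n k) ^ m
overloaded-rare n k m σ b0 P L>0 6Ph≤L m≤bP = *-cancelʳ-≤ _ _ (2 ^ b) {{m^n≢0 2 b}} (begin
    c * 2 ^ b * 2 ^ b     ≡⟨ *-assoc c (2 ^ b) (2 ^ b) ⟩
    c * (2 ^ b * 2 ^ b)   ≡⟨ cong (c *_) (sym (^-distribʳ-* 2 2 b)) ⟩
    c * 4 ^ b             ≤⟨ overloaded-first-moment n k m σ b0 ⟩
    (L + 3 * h) ^ m       ≤⟨ ratio-bound-below (L + 3 * h) L 2 P b m L>0 (m≤m+n L (3 * h)) perturbation m≤bP ⟩
    2 ^ b * L ^ m         ≡⟨ *-comm (2 ^ b) (L ^ m) ⟩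
    L ^ m * 2 ^ b         ∎)
  where
  open ≤-Reasoning
  b : ℕ
  b = suc b0
  c : ℕ
  c = countBy (overloaded σ b0) (allFormulas n k m)
  L : ℕ
  L = length (allClauses n k)
  h : ℕ
  h = countBy (heavyClause k σ) (allClauses n k)
  perturbation : (L + 3 * h) ^ P ≤ 2 * L ^ P
  perturbation = perturbed-power≤double L (3 * h) P (≤-trans L>0 (m≤m+n L (3 * h)))
    (≤-trans (≤-reflexive (regroup P h)) (≤-trans 6Ph≤L (m≤m+n L (3 * h))))
    where regroup : ∀ P h → 2 * P * (3 * h) ≡ 6 * P * h
          regroup = solve-∀

assignments : ∀ n → List (Vec Bool n)
assignments n = allVecs (true ∷ false ∷ []) n

allVecs-complete : {A : Set} (xs : List A) → ∀ {k} (v : Vec A k) → (∀ i → lookup v i ∈ xs) → v ∈ allVecs xs k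
allVecs-complete xs []      entries = here refl
allVecs-complete xs (x ∷ v) entries = ∈-concatMap⁺ (λ y → map (y ∷_) (allVecs xs _))
  (Any.map (λ { refl → ∈-map⁺ (x ∷_) (allVecs-complete xs v (λ i → entries (suc i))) }) (entries zero))

assignments-complete : ∀ {n} (u : Vec Bool n) → u ∈ assignments n
assignments-complete u = allVecs-complete (true ∷ false ∷ []) u (λ i → bool∈ (lookup u i))
  where bool∈ : ∀ b → b ∈ true ∷ false ∷ []
        bool∈ true  = here refl
        bool∈ false = there (here refl)

numHeavy-cong : ∀ {n k m} (σ τ : Assignment n) → (∀ i → σ i ≡ τ i) → (F : Formula n k m) → numHeavy σ F ≡ numHeavy τ F
numHeavy-cong {k = k} σ τ σ≗τ = clauses
  where
  literal : ∀ (l : Lit _) → litSat σ l ≡ litSat τ l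
  literal (i , s) = cong (λ v → does (v ≟ᵇ s)) (σ≗τ i)
  clause : ∀ {k′} (C : Clause _ k′) → numSat σ C ≡ numSat τ C
  clause []      = refl
  clause (l ∷ C) = cong₂ (λ a c → (if a then 1 else 0) + c) (literal l) (clause C)
  clauses : ∀ {m′} (F : Formula _ k m′) → numHeavy σ F ≡ numHeavy τ F
  clauses []      = refl
  clauses (C ∷ F) = cong₂ (λ a c → (if heavy k a then 1 else 0) + c) (clause C) (clauses F)

underLoad : ∀ {n k m} → ℕ → Formula n k m → Bool
underLoad {n} b0 F = all (λ u → numHeavy (lookup u) F ≤ᵇ b0) (assignments n)

underLoad-sound : ∀ {n k m} b0 (F : Formula n k m) → underLoad b0 F ≡ true → ∀ σ → numHeavy σ F ≤ b0
underLoad-sound {n} b0 F ok σ = subst (_≤ b0) (numHeavy-cong _ σ (lookup∘tabulate σ) F)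
  (≤ᵇ⇒≤ _ b0 (All.lookup (all⁺ _ (assignments n) (Equivalence.from T-≡ ok)) (assignments-complete (tabulate σ))))

not-underLoad≤ : ∀ {n k m} b0 (Fs : List (Formula n k m)) →
  countBy (λ F → not (underLoad b0 F)) Fs ≤ sumBy (λ u → countBy (overloaded (lookup u) b0) Fs) (assignments n)
not-underLoad≤ {n} b0 Fs = ≤-trans
  (sumBy-mono _ _ Fs (λ F → some-overloaded (λ u → numHeavy (lookup u) F ≤ᵇ b0) (assignments n)))
  (≤-reflexive (sumBy-swap (λ F u → if overloaded (lookup u) b0 F then 1 else 0) Fs (assignments n)))
  where
  some-overloaded : ∀ {A : Set} (p : A → Bool) us → (if not (all p us) then 1 else 0) ≤ countBy (λ u → not (p u)) us
  some-overloaded p []       = z≤n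
  some-overloaded p (u ∷ us) with p u
  ... | true  = some-overloaded p us
  ... | false = s≤s z≤n

scale : ∀ k → ∃ λ r → ((8 * r) ^ 8 ≤ k) × (k < (8 * suc r) ^ 8)
scale zero    = 0 , z≤n , s≤s z≤n
scale (suc k) with scale k
... | r , lo , hi with (8 * suc r) ^ 8 ≤? suc k
...   | yes next≤ = suc r , next≤ , ≤-<-trans hi (^-monoˡ-< 8 (*-monoʳ-< 8 (n<1+n (suc r))))
...   | no next≰  = r , ≤-trans lo (n≤1+n k) , ≰⇒> next≰

-- For r ≥ 16 consecutive eighth powers differ by at most a factor 2, so k is
-- within a factor 2 of (8r)^8.
scale-upper : ∀ k r → 16 ≤ r → k < (8 * suc r) ^ 8 → k ≤ 2 * (8 * r) ^ 8
scale-upper k r r≥16 hi = begin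
  k                    ≤⟨ <⇒≤ hi ⟩
  (8 * suc r) ^ 8      ≡⟨ ^-distribʳ-* 8 (suc r) 8 ⟩
  8 ^ 8 * suc r ^ 8    ≤⟨ *-monoʳ-≤ (8 ^ 8) [r+1]⁸≤2r⁸ ⟩
  8 ^ 8 * (2 * r ^ 8)  ≡⟨ *-comm-left (8 ^ 8) 2 (r ^ 8) ⟩
  2 * (8 ^ 8 * r ^ 8)  ≡⟨ cong (2 *_) (sym (^-distribʳ-* 8 r 8)) ⟩
  2 * (8 * r) ^ 8      ∎
  where
  open ≤-Reasoning
  [r+1]⁸≤2r⁸ : suc r ^ 8 ≤ 2 * r ^ 8
  [r+1]⁸≤2r⁸ = subst (λ z → z ^ 8 ≤ 2 * r ^ 8) (+-comm r 1)
    (perturbed-power≤double r 1 8 (m≤n+m 1 r) (≤-trans r≥16 (m≤m+n r 1)))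
  *-comm-left : ∀ a b c → a * (b * c) ≡ b * (a * c)
  *-comm-left = solve-∀

scale≥16 : ∀ k r → (8 * 16) ^ 8 ≤ k → k < (8 * suc r) ^ 8 → 16 ≤ r
scale≥16 k r k≥ hi with 16 ≤? r
... | yes r≥16 = r≥16
... | no r≱16  = ⊥-elim (<-irrefl refl (<-≤-trans hi (≤-trans (^-monoˡ-≤ 8 (*-monoʳ-≤ 8 (≰⇒> r≱16))) k≥)))

-- The fraction exponent at scale r: overloaded formulas are those with more than
-- a 2^-(fracExp r) fraction of heavy clauses, and fracExp r ≥ k^(3/4)/100.
fracExp : ℕ → ℕ
fracExp r = 2 ^ 13 * r ^ 6

^-reflectˡ-≤ : ∀ n .{{_ : NonZero n}} x y → x ^ n ≤ y ^ n → x ≤ y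
^-reflectˡ-≤ n x y xⁿ≤yⁿ with x ≤? y
... | yes x≤y = x≤y
... | no x≰y  = ⊥-elim (<⇒≱ (^-monoˡ-< n (≰⇒> x≰y)) xⁿ≤yⁿ)

k³c⁴≤[100·fracExp·c]⁴ : ∀ k r c → k ≤ 2 * (8 * r) ^ 8 → k ^ 3 * c ^ 4 ≤ (100 * (fracExp r * c)) ^ 4
k³c⁴≤[100·fracExp·c]⁴ k r c hi = begin
    k ^ 3 * c ^ 4
  ≤⟨ *-monoˡ-≤ (c ^ 4) (^-monoˡ-≤ 3 hi) ⟩
    (2 * (8 * r) ^ 8) ^ 3 * c ^ 4
  ≡⟨ cong (_* c ^ 4) (trans (^-distribʳ-* 2 ((8 * r) ^ 8) 3)
       (cong (2 ^ 3 *_) (trans (^-*-assoc (8 * r) 8 3) (^-distribʳ-* 8 r 24)))) ⟩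
    2 ^ 3 * (8 ^ 24 * r ^ 24) * c ^ 4
  ≡⟨ regroup (2 ^ 3) (8 ^ 24) (r ^ 24) (c ^ 4) ⟩
    2 ^ 75 * (r ^ 24 * c ^ 4)
  ≤⟨ *-monoˡ-≤ (r ^ 24 * c ^ 4) (m≤m+n (2 ^ 75) (2 ^ 75 + 0)) ⟩
    2 ^ 76 * (r ^ 24 * c ^ 4)
  ≡⟨ cong (λ z → 2 ^ 76 * (z * c ^ 4)) (sym (^-*-assoc r 6 4)) ⟩
    (2 ^ 19) ^ 4 * ((r ^ 6) ^ 4 * c ^ 4)
  ≡⟨ cong ((2 ^ 19) ^ 4 *_) (sym (^-distribʳ-* (r ^ 6) c 4)) ⟩
    (2 ^ 19) ^ 4 * (r ^ 6 * c) ^ 4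
  ≡⟨ sym (^-distribʳ-* (2 ^ 19) (r ^ 6 * c) 4) ⟩
    (2 ^ 19 * (r ^ 6 * c)) ^ 4
  ≤⟨ ^-monoˡ-≤ 4 (≤-trans (≤-reflexive (regroup′ 64 (2 ^ 13) (r ^ 6) c)) (*-monoˡ-≤ (fracExp r * c) (≤ᵇ⇒≤ 64 100 _))) ⟩
    (100 * (fracExp r * c)) ^ 4
  ∎
  where
  open ≤-Reasoning
  regroup : ∀ a b x y → a * (b * x) * y ≡ (a * b) * (x * y)
  regroup = solve-∀
  regroup′ : ∀ x y z w → (x * y) * (z * w) ≡ x * (y * z * w)
  regroup′ = solve-∀

rational≤fracExp : ∀ k r a c → k ≤ 2 * (8 * r) ^ 8 → (100 * a) ^ 4 ≤ k ^ 3 * c ^ 4 → a ≤ fracExp r * c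
rational≤fracExp k r a c hi h = *-cancelˡ-≤ 100
  (^-reflectˡ-≤ 4 (100 * a) (100 * (fracExp r * c)) (≤-trans h (k³c⁴≤[100·fracExp·c]⁴ k r c hi)))

fracAtMost-scale : ∀ k r x b0 m → k ≤ 2 * (8 * r) ^ 8 → x ≤ b0 → b0 * 2 ^ fracExp r ≤ m → FracAtMost k x m
fracAtMost-scale k r x b0 m hi x≤b0 b0P≤m a c c>0 h = begin
  x ^ c * 2 ^ a                   ≤⟨ *-mono-≤ (^-monoˡ-≤ c x≤b0) (^-monoʳ-≤ 2 (rational≤fracExp k r a c hi h)) ⟩
  b0 ^ c * 2 ^ (fracExp r * c)    ≡⟨ cong (b0 ^ c *_) (sym (^-*-assoc 2 (fracExp r) c)) ⟩
  b0 ^ c * (2 ^ fracExp r) ^ c    ≡⟨ sym (^-distribʳ-* b0 (2 ^ fracExp r) c) ⟩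
  (b0 * 2 ^ fracExp r) ^ c        ≤⟨ ^-monoˡ-≤ c b0P≤m ⟩
  m ^ c                           ∎
  where open ≤-Reasoning

power≤twice-shifted : ∀ n k → 2 * k * k ≤ n → k < n → (2 * n) ^ k ≤ 2 * (2 * (n ∸ k)) ^ k
power≤twice-shifted n k 2k²≤n k<n = subst (λ z → z ^ k ≤ 2 * (2 * (n ∸ k)) ^ k) shifted+2k≡2n
  (perturbed-power≤double (2 * (n ∸ k)) (2 * k) k (subst (0 <_) (sym shifted+2k≡2n) 2n>0)
    (≤-trans (≤-reflexive (regroup k)) (subst (2 * (2 * k * k) ≤_) (sym shifted+2k≡2n) (*-monoʳ-≤ 2 2k²≤n))))
  where
  shifted+2k≡2n : 2 * (n ∸ k) + 2 * k ≡ 2 * n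
  shifted+2k≡2n = trans (sym (*-distribˡ-+ 2 (n ∸ k) k)) (cong (2 *_) (m∸n+n≡m (<⇒≤ k<n)))
  2n>0 : 0 < 2 * n
  2n>0 = ≤-trans (s≤s z≤n) (*-monoʳ-≤ 2 (≤-trans (s≤s z≤n) k<n))
  regroup : ∀ k → 2 * k * (2 * k) ≡ 2 * (2 * k * k)
  regroup = solve-∀

fracExp-room : ∀ r → 1 ≤ r → 16 * 2 ^ fracExp r ≤ 2 ^ (3 * gain r)
fracExp-room r r≥1 = begin
  16 * 2 ^ fracExp r    ≡⟨ sym (^-distribˡ-+-* 2 4 (fracExp r)) ⟩
  2 ^ (4 + fracExp r)   ≤⟨ ^-monoʳ-≤ 2 (≤-trans (≤-reflexive (+-comm 4 (fracExp r))) (exponents (r ^ 6) (m^n>0 r {{>-nonZero r≥1}} 6))) ⟩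
  2 ^ (3 * gain r)      ∎
  where
  open ≤-Reasoning
  exponents : ∀ R → 0 < R → 2 ^ 13 * R + 4 ≤ 3 * (2 ^ 15 * R)
  exponents R R>0 = begin
    2 ^ 13 * R + 4       ≤⟨ +-monoʳ-≤ (2 ^ 13 * R) (≤-trans (≤-reflexive (sym (*-identityʳ 4))) (*-monoʳ-≤ 4 R>0)) ⟩
    2 ^ 13 * R + 4 * R   ≡⟨ sym (*-distribʳ-+ R (2 ^ 13) 4) ⟩
    (2 ^ 13 + 4) * R     ≤⟨ *-monoˡ-≤ R (≤ᵇ⇒≤ (2 ^ 13 + 4) (3 * 2 ^ 15) _) ⟩
    (3 * 2 ^ 15) * R     ≡⟨ *-assoc 3 (2 ^ 15) R ⟩
    3 * (2 ^ 15 * R)     ∎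

heavy-clauses-rare : ∀ n k r (σ : Assignment n) → 1 ≤ r → (8 * r) ^ 8 ≤ k → k ≤ 2 * (8 * r) ^ 8 →
  2 * k * k ≤ n → k < n → 6 * 2 ^ fracExp r * countBy (heavyClause k σ) (allClauses n k) ≤ length (allClauses n k)
heavy-clauses-rare n k r σ r≥1 lo hi 2k²≤n k<n = *-cancelˡ-≤ 2 (begin
    2 * (6 * P * h)                         ≡⟨ regroup P h ⟩
    12 * P * h                              ≤⟨ *-monoˡ-≤ h (*-monoˡ-≤ P (≤ᵇ⇒≤ 12 16 _)) ⟩
    16 * P * h                              ≤⟨ *-monoˡ-≤ h (fracExp-room r r≥1) ⟩
    2 ^ (3 * gain r) * h                    ≡⟨ *-comm (2 ^ (3 * gain r)) h ⟩
    h * 2 ^ (3 * gain r)                    ≤⟨ *-monoˡ-≤ (2 ^ (3 * gain r)) (countBy-filter≤ (heavyClause k σ) _ (allVecs (allLits n) k)) ⟩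
    countBy (heavyClause k σ) (allVecs (allLits n) k) * 2 ^ (3 * gain r)
                                            ≤⟨ heavy-sequences-rare n k (tilt r) (2 ^ (3 * gain r)) σ
                                                 (λ s e s+e≡k → heavy-clause-gain r k s e r≥1 s+e≡k lo hi) ⟩
    (2 * n) ^ k                             ≤⟨ power≤twice-shifted n k 2k²≤n k<n ⟩
    2 * (2 * (n ∸ k)) ^ k                   ≤⟨ *-monoʳ-≤ 2 (allClauses≥ n k) ⟩
    2 * length (allClauses n k)             ∎)
  where
  open ≤-Reasoning
  P : ℕ
  P = 2 ^ fracExp r
  h : ℕ
  h = countBy (heavyClause k σ) (allClauses n k)
  regroup : ∀ P h → 2 * (6 * P * h) ≡ 12 * P * h
  regroup = solve-∀

not-underLoad-count : ∀ n k m b0 P → 0 < length (allClauses n k) →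
  (∀ σ → 6 * P * countBy (heavyClause k σ) (allClauses n k) ≤ length (allClauses n k)) → m ≤ suc b0 * P →
  countBy (λ F → not (underLoad b0 F)) (allFormulas n k m) * 2 ^ suc b0 ≤ 2 ^ n * length (allClauses n k) ^ m
not-underLoad-count n k m b0 P L>0 heavy-rare m≤bP = begin
    countBy (λ F → not (underLoad b0 F)) Fs * 2 ^ b
  ≤⟨ *-monoˡ-≤ (2 ^ b) (not-underLoad≤ b0 Fs) ⟩
    sumBy overloadedCount (assignments n) * 2 ^ b
  ≡⟨ *-comm _ (2 ^ b) ⟩
    2 ^ b * sumBy overloadedCount (assignments n)
  ≡⟨ sym (sumBy-scale (2 ^ b) overloadedCount (assignments n)) ⟩
    sumBy (λ u → 2 ^ b * overloadedCount u) (assignments n)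
  ≤⟨ sumBy-mono _ _ (assignments n) (λ u → ≤-trans (≤-reflexive (*-comm (2 ^ b) (overloadedCount u)))
       (overloaded-rare n k m (lookup u) b0 P L>0 (heavy-rare (lookup u)) m≤bP)) ⟩
    sumBy (λ _ → L ^ m) (assignments n)
  ≡⟨ sumBy-const (L ^ m) (assignments n) ⟩
    length (assignments n) * L ^ m
  ≡⟨ cong (_* L ^ m) (length-allVecs (true ∷ false ∷ []) n) ⟩
    2 ^ n * L ^ m
  ∎
  where
  open ≤-Reasoning
  b : ℕ
  b = suc b0
  L : ℕ
  L = length (allClauses n k)
  Fs : List (Formula n k m)
  Fs = allFormulas n k m
  overloadedCount : Vec Bool n → ℕ
  overloadedCount u = countBy (overloaded (lookup u) b0) Fs

not-underLoad-rare : ∀ n k m b0 P j → 0 < length (allClauses n k) →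
  (∀ σ → 6 * P * countBy (heavyClause k σ) (allClauses n k) ≤ length (allClauses n k)) → m ≤ suc b0 * P →
  n + n ≤ suc b0 → suc j ≤ 2 ^ n → suc j * countBy (λ F → not (underLoad b0 F)) (allFormulas n k m) ≤ length (allFormulas n k m)
not-underLoad-rare n k m b0 P j L>0 heavy-rare m≤bP 2n≤b j<2ⁿ = *-cancelʳ-≤ _ _ (2 ^ b) {{m^n≢0 2 b}} (begin
    suc j * bad * 2 ^ b          ≡⟨ *-assoc (suc j) bad (2 ^ b) ⟩
    suc j * (bad * 2 ^ b)        ≤⟨ *-monoʳ-≤ (suc j) (not-underLoad-count n k m b0 P L>0 heavy-rare m≤bP) ⟩
    suc j * (2 ^ n * L ^ m)      ≡⟨ sym (*-assoc (suc j) (2 ^ n) (L ^ m)) ⟩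
    suc j * 2 ^ n * L ^ m        ≤⟨ *-monoˡ-≤ (L ^ m) (*-monoˡ-≤ (2 ^ n) j<2ⁿ) ⟩
    2 ^ n * 2 ^ n * L ^ m        ≡⟨ cong (_* L ^ m) (sym (^-distribˡ-+-* 2 n n)) ⟩
    2 ^ (n + n) * L ^ m          ≤⟨ *-monoˡ-≤ (L ^ m) (^-monoʳ-≤ 2 2n≤b) ⟩
    2 ^ b * L ^ m                ≡⟨ *-comm (2 ^ b) (L ^ m) ⟩
    L ^ m * 2 ^ b                ≡⟨ cong (_* 2 ^ b) (sym (length-allVecs (allClauses n k) m)) ⟩
    length (allFormulas n k m) * 2 ^ b ∎)
  where
  open ≤-Reasoning
  b : ℕ
  b = suc b0
  L : ℕ
  L = length (allClauses n k)
  bad : ℕ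
  bad = countBy (λ F → not (underLoad b0 F)) (allFormulas n k m)

kept-majority : ∀ j g d t → g + d ≡ t → suc j * d ≤ t → j * t ≤ suc j * g
kept-majority j g d t g+d≡t [j+1]d≤t = begin
  j * t          ≡⟨ cong (j *_) (sym g+d≡t) ⟩
  j * (g + d)    ≡⟨ *-distribˡ-+ j g d ⟩
  j * g + j * d  ≤⟨ +-monoʳ-≤ (j * g) jd≤g ⟩
  j * g + g      ≡⟨ +-comm (j * g) g ⟩
  suc j * g      ∎
  where
  open ≤-Reasoning
  jd≤g : j * d ≤ g
  jd≤g = +-cancelˡ-≤ d (j * d) g (≤-trans [j+1]d≤t (≤-reflexive (trans (sym g+d≡t) (+-comm g d))))

load-threshold : ∀ m P .{{_ : NonZero P}} n → 2 * P * n ≤ m →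
  (m / P * P ≤ m) × (m ≤ suc (m / P) * P) × (n + n ≤ suc (m / P))
load-threshold m P n 2Pn≤m = m/n*n≤m m P , <⇒≤ m<[b0+1]P , 2n≤b0+1
  where
  open ≤-Reasoning
  m<[b0+1]P : m < suc (m / P) * P
  m<[b0+1]P = begin-strict
    m                      ≡⟨ m≡m%n+[m/n]*n m P ⟩
    m % P + m / P * P      <⟨ +-monoˡ-< (m / P * P) (m%n<n m P) ⟩
    P + m / P * P          ∎
  2n≤b0+1 : n + n ≤ suc (m / P)
  2n≤b0+1 = <⇒≤ (*-cancelʳ-< P (n + n) (suc (m / P)) (begin-strict
    (n + n) * P            ≡⟨ regroup n P ⟩
    2 * P * n              ≤⟨ 2Pn≤m ⟩
    m                      <⟨ m<[b0+1]P ⟩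
    suc (m / P) * P        ∎))
    where regroup : ∀ n P → (n + n) * P ≡ 2 * P * n
          regroup = solve-∀

density-lower : ∀ D p q n → D * suc q ≤ p → D * n ≤ (p * n) / suc q
density-lower D p q n D[q+1]≤p = begin
  D * n                  ≡⟨ sym (m*n/n≡m (D * n) (suc q)) ⟩
  D * n * suc q / suc q  ≤⟨ /-monoˡ-≤ (suc q) (≤-trans (≤-reflexive (swap D n (suc q))) (*-monoˡ-≤ n D[q+1]≤p)) ⟩
  (p * n) / suc q        ∎
  where
  open ≤-Reasoning
  swap : ∀ a b c → a * b * c ≡ a * c * b
  swap = solve-∀

n<2^n : ∀ n → n < 2 ^ n
n<2^n zero    = s≤s z≤n
n<2^n (suc n) = +-mono-≤ (m^n>0 2 n) (≤-trans (n<2^n n) (m≤m+n (2 ^ n) 0))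

GoodMajority : (n k m j : ℕ) → Set
GoodMajority n k m j = Σ (List (Formula n k m)) λ good →
  (good ⊆ allFormulas n k m) × All (λ F → Good F) good × (j * length (allFormulas n k m) ≤ suc j * length good)

goodMajority : ∀ k r n m j → 16 ≤ r → (8 * r) ^ 8 ≤ k → k ≤ 2 * (8 * r) ^ 8 →
  2 * 2 ^ fracExp r * n ≤ m → suc (2 * k * k + k + j) ≤ n → GoodMajority n k m j
goodMajority k r n m j r≥16 lo hi 2Pn≤m N≤n =
    good
  , filter-⊆ (λ F → underLoad b0 F ≟ᵇ true) Fs
  , All.map (λ {F} ok σ → fracAtMost-scale k r (numHeavy σ F) b0 m hi (underLoad-sound b0 F ok σ) b0P≤m)
            (all-filter (λ F → underLoad b0 F ≟ᵇ true) Fs)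
  , kept-majority j (length good) _ (length Fs) (filter+rejected≡length (underLoad b0) Fs)
      (not-underLoad-rare n k m b0 P j L>0 (λ σ → heavy-clauses-rare n k r σ r≥1 lo hi 2k²≤n k<n) m≤[b0+1]P 2n≤b0+1 j<2ⁿ)
  where
  P : ℕ
  P = 2 ^ fracExp r
  instance
    P≢0 : NonZero P
    P≢0 = m^n≢0 2 (fracExp r)
  b0 : ℕ
  b0 = m / P
  Fs : List (Formula n k m)
  Fs = allFormulas n k m
  good : List (Formula n k m)
  good = filter (λ F → underLoad b0 F ≟ᵇ true) Fs
  b0P≤m : b0 * P ≤ m
  b0P≤m = proj₁ (load-threshold m P n 2Pn≤m)
  m≤[b0+1]P : m ≤ suc b0 * P
  m≤[b0+1]P = proj₁ (proj₂ (load-threshold m P n 2Pn≤m))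
  2n≤b0+1 : n + n ≤ suc b0
  2n≤b0+1 = proj₂ (proj₂ (load-threshold m P n 2Pn≤m))
  r≥1 : 1 ≤ r
  r≥1 = ≤-trans (s≤s z≤n) r≥16
  2k²+k+j<n : 2 * k * k + k + j < n
  2k²+k+j<n = N≤n
  2k²≤n : 2 * k * k ≤ n
  2k²≤n = ≤-trans (≤-trans (m≤m+n (2 * k * k) k) (m≤m+n _ j)) (<⇒≤ 2k²+k+j<n)
  k<n : k < n
  k<n = ≤-<-trans (≤-trans (m≤n+m k (2 * k * k)) (m≤m+n _ j)) 2k²+k+j<n
  j<2ⁿ : suc j ≤ 2 ^ n
  j<2ⁿ = <-trans (≤-<-trans (m≤n+m j (2 * k * k + k)) 2k²+k+j<n) (n<2^n n)
  L>0 : 0 < length (allClauses n k)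
  L>0 = <-≤-trans (m^n>0 (2 * (n ∸ k)) {{>-nonZero (≤-trans (s≤s z≤n) (*-monoʳ-≤ 2 (m<n⇒0<n∸m k<n)))}} k) (allClauses≥ n k)

-- The theorem: K = (8·16)^8 forces scale r ≥ 16; the density threshold is
-- D = 2 · 2^(fracExp r), so m = ⌊p n/(q+1)⌋ ≥ D n; and for confidence j/(j+1)
-- it suffices that n > 2k^2 + k + j.
lemma4p4 : ∃ λ K → (k : ℕ) → K ≤ k →
    ∃ λ D → (p q : ℕ) → D * suc q ≤ p →
    WHP k (λ n → (p * n) / suc q) (λ n F → Good F)
lemma4p4 = (8 * 16) ^ 8 , λ k k≥K → case scale k of λ where
  (r , lo , hi) → let r≥16 = scale≥16 k r k≥K hi in
    2 * 2 ^ fracExp r , λ p q D[q+1]≤p j → suc (2 * k * k + k + j) , λ n N≤n →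
      goodMajority k r n ((p * n) / suc q) j r≥16 lo (scale-upper k r r≥16 hi)
        (density-lower (2 * 2 ^ fracExp r) p q n D[q+1]≤p) N≤n
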